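{- Let $G$ be a complete wheel with $n\geq8$ vertices, with cycle $C=\{c_1,\dots,c_{n-1}\}$ and central vertex $h$. A set $L\subseteq C$ is an NL-landmark set for parameter $k=2$ if and only if it satisfies the following condition: for every $i$, if $c_i,c_{i+1}\notin L$ then $c_{i-2},c_{i-1},c_{i+2},c_{i+3}\in L$. Moreover, $md_2^{NL}(G)=\lfloor n/2\rfloor$.
   Context: The complete wheel on $n$ vertices has vertex set $V=C\cup\{h\}$ with $C=\{c_1,\dots,c_{n-1}\}$, edges $\{c_i,h\}$ and $\{c_i,c_{i+1}\}$ for $1\le i\le n-1$, indices modulo $n-1$. $d(x,y)$ denotes graph distance; $\tau$ separates distinct $u,v$ if $d(u,\tau)\neq d(v,\tau)$. $L\subseteq V$ is an NL-landmark set for parameter $k$ if every pair of distinct $u,v\in V\setminus L$ is separated by at least $k$ distinct vertices of $L$; $md_k^{NL}(G)$ is the minimum cardinality of such a set. -}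

module Defs where

open import Data.Nat using (ℕ; zero; suc; _+_; _∸_; _<_; _≤_; NonZero)
open import Data.Nat.DivMod using (_mod_)
open import Data.Fin using (Fin; toℕ) renaming (zero to fzero; suc to fsuc)
open import Data.Fin.Subset using (Subset; _∈_; _∉_; ∣_∣)
open import Data.Product using (Σ; _×_; ∃; ∃-syntax; _,_)
open import Data.Sum using (_⊎_)
open import Relation.Binary.PropositionalEquality using (_≡_)
open import Relation.Nullary using (¬_)
open import Function.Definitions using (Injective)

-- Complete wheel on n = suc m vertices, vertex set Fin (suc m):
--   hub h = fzero, cycle vertex c_i = fsuc i  (i : Fin m, 0-indexed).
hub : ∀ {m} → Fin (suc m)
hub = fzero

cyc : ∀ m → .{{_ : NonZero m}} → ℕ → Fin (suc m)
cyc m i = fsuc (i mod m)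

CycStep : ∀ {m} → Fin m → Fin m → Set
CycStep {m} i j = (suc (toℕ i) ≡ toℕ j) ⊎ (suc (toℕ i) ≡ m × toℕ j ≡ 0)

data Adj {m : ℕ} : Fin (suc m) → Fin (suc m) → Set where
  spoke₁ : (i : Fin m) → Adj (fsuc i) fzero
  spoke₂ : (i : Fin m) → Adj fzero (fsuc i)
  rim₁   : (i j : Fin m) → CycStep i j → Adj (fsuc i) (fsuc j)
  rim₂   : (i j : Fin m) → CycStep i j → Adj (fsuc j) (fsuc i)

data Walk {m : ℕ} : Fin (suc m) → Fin (suc m) → ℕ → Set where
  here : ∀ {u} → Walk u u 0
  step : ∀ {u w v k} → Adj u w → Walk w v k → Walk u v (suc k)

Dist : ∀ {m} → Fin (suc m) → Fin (suc m) → ℕ → Set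
Dist u v k = Walk u v k × (∀ j → j < k → ¬ Walk u v j)

Separates : ∀ {m} → Fin (suc m) → Fin (suc m) → Fin (suc m) → Set
Separates τ u v = ∃[ a ] ∃[ b ] (Dist u τ a × Dist v τ b × ¬ a ≡ b)

SeparatedBy : ∀ {m} → ℕ → Subset (suc m) → Fin (suc m) → Fin (suc m) → Set
SeparatedBy {m} k L u v =
  Σ (Fin k → Fin (suc m)) λ f → Injective _≡_ _≡_ f × (∀ t → f t ∈ L × Separates (f t) u v)

IsNLLandmark : ∀ {m} → ℕ → Subset (suc m) → Set
IsNLLandmark {m} k L =
  ∀ (u v : Fin (suc m)) → u ∉ L → v ∉ L → ¬ u ≡ v → SeparatedBy k L u v

MdNL : ℕ → ℕ → ℕ → Set
MdNL m k d =
  (Σ (Subset (suc m)) λ L → IsNLLandmark k L × ∣ L ∣ ≡ d)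
  × (∀ (L : Subset (suc m)) → IsNLLandmark k L → d ≤ ∣ L ∣)

module Submission where

-- The wheel has diameter 2, so a vertex τ ∉ {u, v} separates u and v exactly when it is adjacent
-- to one of them but not the other; in particular the hub never separates two other vertices.
-- The theorem's condition is, up to re-indexing, the local condition Flanked: a gap of two
-- consecutive rim vertices outside L is flanked on each side by two landmarks.
--   * Necessity: a gap c_{b+3}, c_{b+4} can only be separated by c_{b+2}, c_{b+5}; and the pairs
--     c_{b+1}, c_{b+3} and c_{b+4}, c_{b+6} would each have a single candidate separator.
--   * Sufficiency: for each pair of non-landmarks, the rim neighbours of each member supply a
--     landmark adjacent to that member and at distance 2 from the other.
--   * Size: under Flanked every four consecutive rim vertices contain two landmarks; summing over
--     the m rotations gives |L| ≥ ⌈m/2⌉ = ⌊n/2⌋, and the alternating set attains this bound.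

open import Defs
open import Data.Nat
  using (ℕ; zero; suc; _+_; _∸_; _*_; _/_; _%_; _≤_; _<_; _≤ᵇ_; _≟_; z≤n; z<s; s≤s; NonZero; >-nonZero⁻¹)
open import Data.Nat.Properties
open import Data.Nat.DivMod
open import Data.Nat.Tactic.RingSolver using (solve-∀)
open import Data.Fin using (Fin; toℕ) renaming (zero to fzero; suc to fsuc)
import Data.Fin.Properties as Fin
open import Data.Fin.Subset using (Subset; _∈_; _∉_; ∣_∣; outside)
open import Data.Fin.Subset.Properties using (_∈?_)
open import Data.Vec using ([]; _∷_; lookup; tabulate; there)
open import Data.Vec.Properties using ([]=⇒lookup; lookup⇒[]=; lookup∘tabulate)
open import Data.Bool using (Bool; true; false; T)
open import Data.Product using (Σ; _×_; _,_; proj₁; proj₂)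
open import Data.Sum using (_⊎_; inj₁; inj₂)
open import Data.Empty using (⊥-elim)
open import Relation.Binary.PropositionalEquality
open import Relation.Nullary using (¬_; Dec; yes; no)
open import Relation.Binary using (tri<; tri≈; tri>)
open import Function.Definitions using (Injective)
open import Function.Bundles using (_⇔_; mk⇔)

num≤ : ∀ {x y} {_ : T (x ≤ᵇ y)} → x ≤ y
num≤ {x} {y} {x≤ᵇy} = ≤ᵇ⇒≤ x y x≤ᵇy

module _ {m : ℕ} where

  adjacent-sym : {u v : Fin (suc m)} → Adj u v → Adj v u
  adjacent-sym (spoke₁ i) = spoke₂ i
  adjacent-sym (spoke₂ i) = spoke₁ i
  adjacent-sym (rim₁ i j s) = rim₂ i j s
  adjacent-sym (rim₂ i j s) = rim₁ i j s

  adjacent-irreflexive : 1 < m → {u : Fin (suc m)} → ¬ Adj u u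
  adjacent-irreflexive 1<m (rim₁ i i s) = no-loop s
    where
    no-loop : ¬ CycStep i i
    no-loop (inj₁ i+1≡i) = 1+n≢n i+1≡i
    no-loop (inj₂ (i+1≡m , i≡0)) = <-irrefl (trans (cong suc (sym i≡0)) i+1≡m) 1<m
  adjacent-irreflexive 1<m (rim₂ i i s) = adjacent-irreflexive 1<m (rim₁ i i s)

  cycStep? : (i j : Fin m) → Dec (CycStep i j)
  cycStep? i j with suc (toℕ i) ≟ toℕ j | suc (toℕ i) ≟ m | toℕ j ≟ 0
  ... | yes p | _ | _ = yes (inj₁ p)
  ... | no _ | yes q | yes r = yes (inj₂ (q , r))
  ... | no ¬p | no ¬q | _ = no λ { (inj₁ p) → ¬p p ; (inj₂ (q , _)) → ¬q q }
  ... | no ¬p | _ | no ¬r = no λ { (inj₁ p) → ¬p p ; (inj₂ (_ , r)) → ¬r r }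

  adjacent? : (u v : Fin (suc m)) → Dec (Adj u v)
  adjacent? fzero fzero = no λ ()
  adjacent? fzero (fsuc j) = yes (spoke₂ j)
  adjacent? (fsuc i) fzero = yes (spoke₁ i)
  adjacent? (fsuc i) (fsuc j) with cycStep? i j | cycStep? j i
  ... | yes s | _ = yes (rim₁ i j s)
  ... | no _ | yes s = yes (rim₂ j i s)
  ... | no ¬s | no ¬s′ = no λ { (rim₁ _ _ s) → ¬s s ; (rim₂ _ _ s) → ¬s′ s }

  walk₀ : {u v : Fin (suc m)} → Walk u v 0 → u ≡ v
  walk₀ here = refl

  dist-adjacent : {u v : Fin (suc m)} → ¬ u ≡ v → Adj u v → Dist u v 1
  dist-adjacent u≢v u~v = step u~v here , λ { zero _ w → u≢v (walk₀ w) ; (suc j) (s≤s ()) _ }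

  dist-nonadjacent : {u v : Fin (suc m)} → ¬ u ≡ v → ¬ Adj u v → Dist u v 2
  dist-nonadjacent {u} {v} u≢v u≁v = via-hub u v u≢v u≁v ,
    λ { zero _ w → u≢v (walk₀ w) ; (suc zero) _ w → u≁v (walk₁ w) ; (suc (suc j)) (s≤s (s≤s ())) _ }
    where
    walk₁ : ∀ {u v} → Walk {m} u v 1 → Adj u v
    walk₁ (step u~v here) = u~v
    via-hub : ∀ u v → ¬ u ≡ v → ¬ Adj u v → Walk u v 2
    via-hub fzero fzero u≢v _ = ⊥-elim (u≢v refl)
    via-hub fzero (fsuc j) _ u≁v = ⊥-elim (u≁v (spoke₂ j))
    via-hub (fsuc i) fzero _ u≁v = ⊥-elim (u≁v (spoke₁ i))
    via-hub (fsuc i) (fsuc j) _ _ = step (spoke₁ i) (step (spoke₂ j) here)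

  dist-unique : {u v : Fin (suc m)} {a b : ℕ} → Dist u v a → Dist u v b → a ≡ b
  dist-unique {a = a} {b} (walk-a , a-min) (walk-b , b-min) with <-cmp a b
  ... | tri< a<b _ _ = ⊥-elim (b-min a a<b walk-a)
  ... | tri≈ _ a≡b _ = a≡b
  ... | tri> _ _ b<a = ⊥-elim (a-min b b<a walk-b)

  separator-adjacent-to-one : {τ u v : Fin (suc m)} → Separates τ u v → ¬ u ≡ τ → ¬ v ≡ τ →
    (Adj u τ × ¬ Adj v τ) ⊎ (¬ Adj u τ × Adj v τ)
  separator-adjacent-to-one {τ} {u} {v} (a , b , du , dv , a≢b) u≢τ v≢τ with adjacent? u τ | adjacent? v τ
  ... | yes u~τ | yes v~τ = ⊥-elim (a≢b (trans (dist-unique du (dist-adjacent u≢τ u~τ))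
                                             (dist-unique (dist-adjacent v≢τ v~τ) dv)))
  ... | no u≁τ | no v≁τ = ⊥-elim (a≢b (trans (dist-unique du (dist-nonadjacent u≢τ u≁τ))
                                           (dist-unique (dist-nonadjacent v≢τ v≁τ) dv)))
  ... | yes u~τ | no v≁τ = inj₁ (u~τ , v≁τ)
  ... | no u≁τ | yes v~τ = inj₂ (u≁τ , v~τ)

  adjacent-to-one⇒separates : {τ u v : Fin (suc m)} → ¬ u ≡ τ → ¬ v ≡ τ → Adj u τ → ¬ Adj v τ →
    Separates τ u v
  adjacent-to-one⇒separates u≢τ v≢τ u~τ v≁τ =
    1 , 2 , dist-adjacent u≢τ u~τ , dist-nonadjacent v≢τ v≁τ , λ ()

  separates-sym : {τ u v : Fin (suc m)} → Separates τ u v → Separates τ v u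
  separates-sym (a , b , du , dv , a≢b) = b , a , dv , du , λ b≡a → a≢b (sym b≡a)

  record TwoSeparators (L : Subset (suc m)) (u v : Fin (suc m)) : Set where
    constructor two
    field
      {first second} : Fin (suc m)
      distinct : ¬ first ≡ second
      first∈L : first ∈ L
      second∈L : second ∈ L
      first-separates : Separates first u v
      second-separates : Separates second u v

  module _ {L : Subset (suc m)} {u v : Fin (suc m)} where

    two⇒separatedBy : TwoSeparators L u v → SeparatedBy 2 L u v
    two⇒separatedBy (two {t₀} {t₁} t₀≢t₁ t₀∈L t₁∈L s₀ s₁) = pick , pick-injective , pick-property
      where
      pick : Fin 2 → Fin (suc m)
      pick fzero = t₀
      pick (fsuc _) = t₁
      pick-injective : Injective _≡_ _≡_ pick
      pick-injective {fzero} {fzero} _ = refl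
      pick-injective {fzero} {fsuc fzero} t₀≡t₁ = ⊥-elim (t₀≢t₁ t₀≡t₁)
      pick-injective {fsuc fzero} {fzero} t₁≡t₀ = ⊥-elim (t₀≢t₁ (sym t₁≡t₀))
      pick-injective {fsuc fzero} {fsuc fzero} _ = refl
      pick-property : ∀ t → pick t ∈ L × Separates (pick t) u v
      pick-property fzero = t₀∈L , s₀
      pick-property (fsuc _) = t₁∈L , s₁

    separatedBy⇒two : SeparatedBy 2 L u v → TwoSeparators L u v
    separatedBy⇒two (f , f-injective , f-property) =
      two (λ f0≡f1 → 0≢1 (f-injective f0≡f1))
          (proj₁ (f-property fzero)) (proj₁ (f-property (fsuc fzero)))
          (proj₂ (f-property fzero)) (proj₂ (f-property (fsuc fzero)))
      where
      0≢1 : ¬ fzero ≡ fsuc {1} fzero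
      0≢1 ()

    separators-among : ∀ {p q} → (∀ {t} → t ∈ L → Separates t u v → t ≡ p ⊎ t ≡ q) →
      SeparatedBy 2 L u v → p ∈ L × q ∈ L
    separators-among among sep with separatedBy⇒two sep
    ... | two {t₀} {t₁} t₀≢t₁ t₀∈L t₁∈L s₀ s₁ = both (among t₀∈L s₀) (among t₁∈L s₁)
      where
      both : t₀ ≡ _ ⊎ t₀ ≡ _ → t₁ ≡ _ ⊎ t₁ ≡ _ → _ ∈ L × _ ∈ L
      both (inj₁ refl) (inj₁ refl) = ⊥-elim (t₀≢t₁ refl)
      both (inj₁ refl) (inj₂ refl) = t₀∈L , t₁∈L
      both (inj₂ refl) (inj₁ refl) = t₁∈L , t₀∈L
      both (inj₂ refl) (inj₂ refl) = ⊥-elim (t₀≢t₁ refl)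

    single-separator : ∀ {p} → (∀ {t} → t ∈ L → Separates t u v → t ≡ p) → ¬ SeparatedBy 2 L u v
    single-separator only sep with separatedBy⇒two sep
    ... | two t₀≢t₁ t₀∈L t₁∈L s₀ s₁ = t₀≢t₁ (trans (only t₀∈L s₀) (sym (only t₁∈L s₁)))

    one-from-each : ∀ {p q r s} → p ∈ L ⊎ q ∈ L → r ∈ L ⊎ s ∈ L →
      Separates p u v → Separates q u v → Separates r u v → Separates s u v →
      ¬ p ≡ r → ¬ p ≡ s → ¬ q ≡ r → ¬ q ≡ s → SeparatedBy 2 L u v
    one-from-each (inj₁ p∈L) (inj₁ r∈L) sp _ sr _ p≢r _ _ _ = two⇒separatedBy (two p≢r p∈L r∈L sp sr)
    one-from-each (inj₁ p∈L) (inj₂ s∈L) sp _ _ ss _ p≢s _ _ = two⇒separatedBy (two p≢s p∈L s∈L sp ss)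
    one-from-each (inj₂ q∈L) (inj₁ r∈L) _ sq sr _ _ _ q≢r _ = two⇒separatedBy (two q≢r q∈L r∈L sq sr)
    one-from-each (inj₂ q∈L) (inj₂ s∈L) _ sq _ ss _ _ _ q≢s = two⇒separatedBy (two q≢s q∈L s∈L sq ss)

  separatedBy-sym : {L : Subset (suc m)} {u v : Fin (suc m)} →
    SeparatedBy 2 L u v → SeparatedBy 2 L v u
  separatedBy-sym sep with separatedBy⇒two sep
  ... | two t₀≢t₁ t₀∈L t₁∈L s₀ s₁ =
    two⇒separatedBy (two t₀≢t₁ t₀∈L t₁∈L (separates-sym s₀) (separates-sym s₁))

module Rim (m : ℕ) .{{_ : NonZero m}} where

  c : ℕ → Fin (suc m)
  c = cyc m

  record _≈_ (x y : ℕ) : Set where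
    constructor ⟨_⟩
    field residue : x % m ≡ y % m

  ≈-sym : ∀ {x y} → x ≈ y → y ≈ x
  ≈-sym ⟨ e ⟩ = ⟨ sym e ⟩

  ≈-trans : ∀ {x y z} → x ≈ y → y ≈ z → x ≈ z
  ≈-trans ⟨ e ⟩ ⟨ f ⟩ = ⟨ trans e f ⟩

  ≡⇒≈ : ∀ {x y} → x ≡ y → x ≈ y
  ≡⇒≈ e = ⟨ cong (_% m) e ⟩

  toℕ-mod : ∀ x → toℕ (x mod m) ≡ x % m
  toℕ-mod x = Fin.toℕ-fromℕ< (m%n<n x m)

  ≈⇒c≡ : ∀ {x y} → x ≈ y → c x ≡ c y
  ≈⇒c≡ {x} {y} ⟨ e ⟩ = cong fsuc (Fin.toℕ-injective (trans (toℕ-mod x) (trans e (sym (toℕ-mod y)))))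

  c≡⇒≈ : ∀ {x y} → c x ≡ c y → x ≈ y
  c≡⇒≈ {x} {y} e = ⟨ trans (sym (toℕ-mod x)) (trans (cong toℕ (Fin.suc-injective e)) (toℕ-mod y)) ⟩

  c-toℕ : (i : Fin m) → c (toℕ i) ≡ fsuc i
  c-toℕ i = cong fsuc (Fin.toℕ-injective (trans (toℕ-mod (toℕ i)) (m<n⇒m%n≡m (Fin.toℕ<n i))))

  c-periodic : ∀ x → c (x + m) ≡ c x
  c-periodic x = ≈⇒c≡ ⟨ [m+n]%n≡m%n x m ⟩

  +-congˡ-≈ : ∀ x {a b} → a ≈ b → (x + a) ≈ (x + b)
  +-congˡ-≈ x {a} {b} ⟨ e ⟩ =
    ⟨ trans (%-distribˡ-+ x a m) (trans (cong (λ r → (x % m + r) % m) e) (sym (%-distribˡ-+ x b m))) ⟩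

  +-cancelˡ-≈ : ∀ x {a b} → (x + a) ≈ (x + b) → a ≈ b
  +-cancelˡ-≈ x {a} {b} e =
    ≈-trans (≈-sym (undo-shift a)) (≈-trans (+-congˡ-≈ (m ∸ x % m) e) (undo-shift b))
    where
    -- Adding m ∸ x % m undoes adding x, because (m ∸ x % m) + x is a multiple of m.
    undo-shift : ∀ a → ((m ∸ x % m) + (x + a)) ≈ a
    undo-shift a = ⟨ begin
        ((m ∸ x % m) + (x + a)) % m               ≡⟨ cong (_% m) (sym (+-assoc (m ∸ x % m) x a)) ⟩
        (((m ∸ x % m) + x) + a) % m               ≡⟨ cong (λ z → (z + a) % m) multiple ⟩
        (suc (x / m) * m + a) % m                 ≡⟨ cong (_% m) (+-comm (suc (x / m) * m) a) ⟩
        (a + suc (x / m) * m) % m                 ≡⟨ [m+kn]%n≡m%n a (suc (x / m)) m ⟩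
        a % m                                     ∎ ⟩
      where
      open ≡-Reasoning
      multiple : (m ∸ x % m) + x ≡ suc (x / m) * m
      multiple = begin
        (m ∸ x % m) + x                       ≡⟨ cong ((m ∸ x % m) +_) (m≡m%n+[m/n]*n x m) ⟩
        (m ∸ x % m) + (x % m + (x / m) * m)   ≡⟨ sym (+-assoc (m ∸ x % m) (x % m) _) ⟩
        ((m ∸ x % m) + x % m) + (x / m) * m   ≡⟨ cong (_+ (x / m) * m) (m∸n+n≡m (m%n≤n x m)) ⟩
        m + (x / m) * m                       ∎

  ≈⇒≡ : ∀ {a b} → a < m → b < m → a ≈ b → a ≡ b
  ≈⇒≡ a<m b<m ⟨ e ⟩ = trans (sym (m<n⇒m%n≡m a<m)) (trans e (m<n⇒m%n≡m b<m))

  suc-residue : ∀ x → suc x % m ≡ suc (x % m) % m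
  suc-residue x = trans (cong (λ z → suc z % m) (m≡m%n+[m/n]*n x m)) ([m+kn]%n≡m%n (suc (x % m)) (x / m) m)

  suc-mod : ∀ x → (suc x % m ≡ suc (x % m) × suc (x % m) < m) ⊎ (suc x % m ≡ 0 × suc (x % m) ≡ m)
  suc-mod x with m≤n⇒m<n∨m≡n (m%n<n x m)
  ... | inj₁ lt = inj₁ (trans (suc-residue x) (m<n⇒m%n≡m lt) , lt)
  ... | inj₂ eq = inj₂ (trans (suc-residue x) (trans (cong (_% m) eq) (n%n≡0 m)) , eq)

  ≈⇒step : ∀ x y → suc x ≈ y → CycStep (x mod m) (y mod m)
  ≈⇒step x y ⟨ e ⟩ with suc-mod x
  ... | inj₁ (e′ , _) = inj₁ (trans (cong suc (toℕ-mod x)) (trans (sym e′) (trans e (sym (toℕ-mod y)))))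
  ... | inj₂ (e′ , wrap) = inj₂ (trans (cong suc (toℕ-mod x)) wrap , trans (toℕ-mod y) (trans (sym e) e′))

  step⇒≈ : ∀ x y → CycStep (x mod m) (y mod m) → suc x ≈ y
  step⇒≈ x y (inj₁ p) with suc-mod x
  ... | inj₁ (e , _) = ⟨ trans e (trans (cong suc (sym (toℕ-mod x))) (trans p (toℕ-mod y))) ⟩
  ... | inj₂ (_ , wrap) = ⊥-elim (<-irrefl y%m≡m (m%n<n y m))
    where
    y%m≡m : y % m ≡ m
    y%m≡m = trans (sym (toℕ-mod y)) (trans (sym p) (trans (cong suc (toℕ-mod x)) wrap))
  step⇒≈ x y (inj₂ (p , q)) with suc-mod x
  ... | inj₁ (_ , no-wrap) = ⊥-elim (<-irrefl (trans (cong suc (sym (toℕ-mod x))) p) no-wrap)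
  ... | inj₂ (e , _) = ⟨ trans e (sym (trans (sym (toℕ-mod y)) q)) ⟩

  adjacent⇒successor : ∀ x y → Adj (c x) (c y) → (suc x ≈ y) ⊎ (suc y ≈ x)
  adjacent⇒successor x y (rim₁ _ _ s) = inj₁ (step⇒≈ x y s)
  adjacent⇒successor x y (rim₂ _ _ s) = inj₂ (step⇒≈ y x s)

  -- In what follows rim vertices are written c (b + a): a base index b and a small offset a.
  -- The next lemmas move summands between base and offset, and drop multiples of m.

  c-reassoc : ∀ b j a → c ((b + j) + a) ≡ c (b + (j + a))
  c-reassoc b j a = cong c (+-assoc b j a)

  c-shift : ∀ b s a → c ((b + s) + a) ≡ c (b + (a + s))
  c-shift b s a = trans (c-reassoc b s a) (cong (λ z → c (b + z)) (+-comm s a))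

  c-wrap : ∀ b a → c (b + (a + m)) ≡ c (b + a)
  c-wrap b a = trans (sym (c-reassoc b a m)) (c-periodic (b + a))

  anchor : (q : Fin m) → ∀ a s → a + s ≡ m → c ((toℕ q + s) + a) ≡ fsuc q
  anchor q a s a+s≡m = begin
    c ((toℕ q + s) + a)   ≡⟨ c-shift (toℕ q) s a ⟩
    c (toℕ q + (a + s))   ≡⟨ cong (λ z → c (toℕ q + z)) a+s≡m ⟩
    c (toℕ q + m)         ≡⟨ c-periodic (toℕ q) ⟩
    c (toℕ q)             ≡⟨ c-toℕ q ⟩
    fsuc q                ∎
    where open ≡-Reasoning

  rim-adjacent : ∀ b a → Adj (c (b + a)) (c (b + suc a))
  rim-adjacent b a = rim₁ _ _ (≈⇒step (b + a) (b + suc a) (≡⇒≈ (sym (+-suc b a))))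

  rim-adjacent′ : ∀ b a → Adj (c (b + suc a)) (c (b + a))
  rim-adjacent′ b a = adjacent-sym (rim-adjacent b a)

  rim-neighbours : ∀ b a τ → Adj (c (b + suc a)) τ →
    τ ≡ hub ⊎ τ ≡ c (b + a) ⊎ τ ≡ c (b + suc (suc a))
  rim-neighbours b a fzero _ = inj₁ refl
  rim-neighbours b a (fsuc t) τ~ with adjacent⇒successor (b + suc a) (toℕ t) (subst (Adj _) (sym (c-toℕ t)) τ~)
  ... | inj₁ e = inj₂ (inj₂ (trans (sym (c-toℕ t)) (≈⇒c≡ (≈-trans (≈-sym e) (≡⇒≈ (sym (+-suc b (suc a))))))))
  ... | inj₂ e = inj₂ (inj₁ (trans (sym (c-toℕ t)) (≈⇒c≡ (+-cancelˡ-≈ 1 (≈-trans e (≡⇒≈ (+-suc b a)))))))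

  rim-neighbour : ∀ {τ} b a x → Adj (c (b + suc a)) τ → ¬ Adj (c x) τ →
    τ ≡ c (b + a) ⊎ τ ≡ c (b + suc (suc a))
  rim-neighbour {τ} b a x adj ¬adj with rim-neighbours b a τ adj
  ... | inj₁ refl = ⊥-elim (¬adj (spoke₁ _))
  ... | inj₂ τ-rim = τ-rim

  rim-distinct : ∀ b a d → 0 < d → d < m → ¬ c (b + a) ≡ c (b + (a + d))
  rim-distinct b a d 0<d d<m e = <-irrefl (≈⇒≡ (>-nonZero⁻¹ m) d<m (+-cancelˡ-≈ (b + a) offsets)) 0<d
    where
    offsets : ((b + a) + 0) ≈ ((b + a) + d)
    offsets = subst₂ _≈_ (sym (+-identityʳ (b + a))) (sym (+-assoc b a d)) (c≡⇒≈ e)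

  rim-nonadjacent : ∀ b a d → 2 ≤ d → suc d < m → ¬ Adj (c (b + a)) (c (b + (a + d)))
  rim-nonadjacent b a d 2≤d d+1<m adj with adjacent⇒successor _ _ adj
  ... | inj₁ e = <-irrefl (≈⇒≡ (<-trans 2≤d d<m) d<m (+-cancelˡ-≈ (b + a) forward)) 2≤d
    where
    d<m : d < m
    d<m = <-trans (n<1+n d) d+1<m
    forward : ((b + a) + 1) ≈ ((b + a) + d)
    forward = subst₂ _≈_ (+-comm 1 (b + a)) (sym (+-assoc b a d)) e
  ... | inj₂ e = 1+n≢0 (≈⇒≡ d+1<m (>-nonZero⁻¹ m) (+-cancelˡ-≈ (b + a) backward))
    where
    backward : ((b + a) + suc d) ≈ ((b + a) + 0)
    backward = subst₂ _≈_ (trans (cong suc (sym (+-assoc b a d))) (sym (+-suc (b + a) d)))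
                          (sym (+-identityʳ (b + a))) e

  index-difference : ∀ i j → i < m → j < m → ¬ i ≡ j → Σ ℕ λ d → 0 < d × d < m × (i + d) ≈ j
  index-difference i j i<m j<m i≢j with <-cmp i j
  ... | tri< i<j _ _ = j ∸ i , m<n⇒0<n∸m i<j , ≤-<-trans (m∸n≤m j i) j<m , ≡⇒≈ (m+[n∸m]≡n (<⇒≤ i<j))
  ... | tri≈ _ i≡j _ = ⊥-elim (i≢j i≡j)
  ... | tri> _ _ j<i = (m + j) ∸ i , m<n⇒0<n∸m (<-≤-trans i<m (m≤m+n m j)) , difference<m ,
        ≈-trans (≡⇒≈ (m+[n∸m]≡n i≤m+j)) ⟨ trans (cong (_% m) (+-comm m j)) ([m+n]%n≡m%n j m) ⟩
    where
    i≤m+j : i ≤ m + j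
    i≤m+j = ≤-trans (<⇒≤ i<m) (m≤m+n m j)
    difference<m : (m + j) ∸ i < m
    difference<m = +-cancelʳ-< i ((m + j) ∸ i) m
      (subst (_< m + i) (sym (m∸n+n≡m i≤m+j)) (+-monoʳ-< m j<i))

sumTo : (ℕ → ℕ) → ℕ → ℕ
sumTo f zero = 0
sumTo f (suc n) = sumTo f n + f n

sumTo-head : ∀ f n → sumTo f (suc n) ≡ f 0 + sumTo (λ x → f (suc x)) n
sumTo-head f zero = +-comm 0 (f 0)
sumTo-head f (suc n) = trans (cong (_+ f (suc n)) (sumTo-head f n)) (+-assoc (f 0) _ _)

sumTo-cong : ∀ {f g} n → (∀ x → f x ≡ g x) → sumTo f n ≡ sumTo g n
sumTo-cong zero f≗g = refl
sumTo-cong (suc n) f≗g = cong₂ _+_ (sumTo-cong n f≗g) (f≗g n)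

sumTo-+ : ∀ f g n → sumTo (λ x → f x + g x) n ≡ sumTo f n + sumTo g n
sumTo-+ f g zero = refl
sumTo-+ f g (suc n) =
  trans (cong (_+ (f n + g n)) (sumTo-+ f g n)) (+-+-interchange (sumTo f n) (sumTo g n) (f n) (g n))
  where
  +-+-interchange : ∀ a b c d → (a + b) + (c + d) ≡ (a + c) + (b + d)
  +-+-interchange = solve-∀

sumTo-mono : ∀ {f g} n → (∀ x → f x ≤ g x) → sumTo f n ≤ sumTo g n
sumTo-mono zero f≤g = z≤n
sumTo-mono (suc n) f≤g = +-mono-≤ (sumTo-mono n f≤g) (f≤g n)

sumTo-const : ∀ a n → sumTo (λ _ → a) n ≡ n * a
sumTo-const a zero = refl
sumTo-const a (suc n) = trans (cong (_+ a) (sumTo-const a n)) (+-comm (n * a) a)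

sumTo-rotate : ∀ m f → (∀ x → f (x + m) ≡ f x) → ∀ s → sumTo (λ x → f (x + s)) m ≡ sumTo f m
sumTo-rotate m f periodic zero = sumTo-cong m (λ x → cong f (+-identityʳ x))
sumTo-rotate m f periodic (suc s) = begin
  sumTo (λ x → f (x + suc s)) m    ≡⟨ sumTo-cong m (λ x → cong f (+-suc x s)) ⟩
  sumTo (λ x → g (suc x)) m        ≡⟨ rotate-once ⟩
  sumTo g m                        ≡⟨ sumTo-rotate m f periodic s ⟩
  sumTo f m                        ∎
  where
  open ≡-Reasoning
  g : ℕ → ℕ
  g x = f (x + s)
  g-periodic : g m ≡ g 0
  g-periodic = trans (cong f (+-comm m s)) (periodic s)
  rotate-once : sumTo (λ x → g (suc x)) m ≡ sumTo g m
  rotate-once = +-cancelʳ-≡ (g 0) _ _ (begin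
    sumTo (λ x → g (suc x)) m + g 0    ≡⟨ +-comm _ (g 0) ⟩
    g 0 + sumTo (λ x → g (suc x)) m    ≡⟨ sumTo-head g m ⟨
    sumTo g m + g m                    ≡⟨ cong (sumTo g m +_) g-periodic ⟩
    sumTo g m + g 0                    ∎)

ind : Bool → ℕ
ind true = 1
ind false = 0

∣∷∣ : ∀ {n} x (t : Subset n) → ∣ x ∷ t ∣ ≡ ind x + ∣ t ∣
∣∷∣ true t = refl
∣∷∣ false t = refl

∣∣-as-sum : ∀ {n} (t : Subset n) (g : ℕ → ℕ) → (∀ (i : Fin n) → g (toℕ i) ≡ ind (lookup t i)) →
  ∣ t ∣ ≡ sumTo g n
∣∣-as-sum [] g _ = refl
∣∣-as-sum {suc n} (x ∷ t) g g-ind = begin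
  ∣ x ∷ t ∣                               ≡⟨ ∣∷∣ x t ⟩
  ind x + ∣ t ∣                           ≡⟨ cong₂ _+_ (sym (g-ind fzero)) entries ⟩
  g 0 + sumTo (λ y → g (suc y)) n         ≡⟨ sumTo-head g n ⟨
  sumTo g (suc n)                         ∎
  where
  open ≡-Reasoning
  entries : ∣ t ∣ ≡ sumTo (λ y → g (suc y)) n
  entries = ∣∣-as-sum t (λ y → g (suc y)) (λ i → g-ind (fsuc i))

alternating : ℕ → Bool
alternating zero = true
alternating (suc zero) = false
alternating (suc (suc n)) = alternating n

alternating-sum : ∀ n → sumTo (λ x → ind (alternating x)) n ≡ suc n / 2
alternating-sum zero = refl
alternating-sum (suc zero) = refl
alternating-sum (suc (suc n)) = begin
  (sumTo f n + f n) + f (suc n)   ≡⟨ +-assoc (sumTo f n) _ _ ⟩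
  sumTo f n + (f n + f (suc n))   ≡⟨ cong₂ _+_ (alternating-sum n) (one-of-two n) ⟩
  suc n / 2 + 1                   ≡⟨ +-comm (suc n / 2) 1 ⟩
  suc (suc n / 2)                 ≡⟨ m/n≡1+[m∸n]/n {3 + n} {2} num≤ ⟨
  (3 + n) / 2                     ∎
  where
  open ≡-Reasoning
  f : ℕ → ℕ
  f x = ind (alternating x)
  one-of-two : ∀ n → f n + f (suc n) ≡ 1
  one-of-two zero = refl
  one-of-two (suc zero) = refl
  one-of-two (suc (suc n)) = one-of-two n

alternating-covers : ∀ n → alternating n ≡ true ⊎ alternating (suc n) ≡ true
alternating-covers zero = inj₁ refl
alternating-covers (suc zero) = inj₂ refl
alternating-covers (suc (suc n)) = alternating-covers n

half-bound : ∀ m s → m * 2 ≤ (s + s) + (s + s) → suc m / 2 ≤ s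
half-bound m s 2m≤4s = ≤-pred (m<n*o⇒m/o<n {suc m} {suc s} {2} (s≤s (s≤s m≤2s)))
  where
  m≤2s : m ≤ s * 2
  m≤2s = *-cancelʳ-≤ m (s * 2) 2 (subst (m * 2 ≤_) (four-s s) 2m≤4s)
    where
    four-s : ∀ s → (s + s) + (s + s) ≡ (s * 2) * 2
    four-s = solve-∀

-- Wheels with n = m + 1 ≥ 8 vertices, m = 7 + k rim vertices.
module Landmarks (k : ℕ) where

  m : ℕ
  m = 7 + k

  open Rim m

  Flanked : Subset (suc m) → Set
  Flanked L = ∀ b → c (b + 3) ∉ L → c (b + 4) ∉ L →
    c (b + 1) ∈ L × c (b + 2) ∈ L × c (b + 5) ∈ L × c (b + 6) ∈ L

  adjacent⇒distinct : {u v : Fin (suc m)} → Adj u v → ¬ u ≡ v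
  adjacent⇒distinct u~v refl = adjacent-irreflexive num≤ u~v

  -- Vertices at distance 2: distinct and non-adjacent.
  record Far (u v : Fin (suc m)) : Set where
    constructor far
    field
      distinct : ¬ u ≡ v
      nonadjacent : ¬ Adj u v

  far-sym : {u v : Fin (suc m)} → Far u v → Far v u
  far-sym (far u≢v u≁v) = far (λ v≡u → u≢v (sym v≡u)) (λ v~u → u≁v (adjacent-sym v~u))

  rim-far : ∀ b a d → 2 ≤ d → suc d < m → Far (c (b + a)) (c (b + (a + d)))
  rim-far b a d 2≤d d+1<m =
    far (rim-distinct b a d (<-trans z<s 2≤d) (<-trans (n<1+n d) d+1<m)) (rim-nonadjacent b a d 2≤d d+1<m)

  near-far⇒separates : {τ u v : Fin (suc m)} → Adj u τ → Far v τ → Separates τ u v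
  near-far⇒separates u~τ (far v≢τ v≁τ) = adjacent-to-one⇒separates (adjacent⇒distinct u~τ) v≢τ u~τ v≁τ

  far-near⇒separates : {τ u v : Fin (suc m)} → Far u τ → Adj v τ → Separates τ u v
  far-near⇒separates u-far v~τ = separates-sym (near-far⇒separates v~τ u-far)

  module _ (L : Subset (suc m)) where

    ∈-resp : ∀ {x y} → x ≡ y → x ∈ L → y ∈ L
    ∈-resp = subst (_∈ L)

    ∉⇒≢ : ∀ {x τ} → τ ∈ L → x ∉ L → ¬ x ≡ τ
    ∉⇒≢ τ∈L x∉L x≡τ = x∉L (∈-resp (sym x≡τ) τ∈L)

    -- A landmark separating the non-landmarks c_{b+1+a}, c_{b+1+a′} is a rim neighbour of one of
    -- them (the hub is adjacent to both) and is not adjacent to the other.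
    separator-position : ∀ {t} b a a′ → t ∈ L → c (b + suc a) ∉ L → c (b + suc a′) ∉ L →
      Separates t (c (b + suc a)) (c (b + suc a′)) →
      ((t ≡ c (b + a) ⊎ t ≡ c (b + suc (suc a))) × ¬ Adj (c (b + suc a′)) t)
      ⊎ ((t ≡ c (b + a′) ⊎ t ≡ c (b + suc (suc a′))) × ¬ Adj (c (b + suc a)) t)
    separator-position {t} b a a′ t∈L u∉L v∉L sep
      with separator-adjacent-to-one sep (∉⇒≢ t∈L u∉L) (∉⇒≢ t∈L v∉L)
    ... | inj₁ (u~t , v≁t) = inj₁ (rim-neighbour b a (b + suc a′) u~t v≁t , v≁t)
    ... | inj₂ (u≁t , v~t) = inj₂ (rim-neighbour b a′ (b + suc a) v~t u≁t , u≁t)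

    -- For a gap c_{b+3}, c_{b+4}: its only possible separators are c_{b+2}, c_{b+5}, so
    -- both are landmarks; and if c_{b+1} (resp. c_{b+6}) were not a landmark, the pair c_{b+1}, c_{b+3}
    -- (resp. c_{b+4}, c_{b+6}) would have c_b (resp. c_{b+7}) as its only possible separator.
    landmark⇒flanked : IsNLLandmark 2 L → Flanked L
    landmark⇒flanked isL b o3 o4 = left , proj₁ inner , proj₂ inner , right
      where
      inner : c (b + 2) ∈ L × c (b + 5) ∈ L
      inner = separators-among gap-separator (isL _ _ o3 o4 (rim-distinct b 3 1 num≤ num≤))
        where
        gap-separator : ∀ {t} → t ∈ L → Separates t (c (b + 3)) (c (b + 4)) → t ≡ c (b + 2) ⊎ t ≡ c (b + 5)
        gap-separator t∈L sep with separator-position b 2 3 t∈L o3 o4 sep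
        ... | inj₁ (inj₁ t≡c₂ , _) = inj₁ t≡c₂
        ... | inj₁ (inj₂ t≡c₄ , _) = ⊥-elim (o4 (∈-resp t≡c₄ t∈L))
        ... | inj₂ (inj₁ t≡c₃ , _) = ⊥-elim (o3 (∈-resp t≡c₃ t∈L))
        ... | inj₂ (inj₂ t≡c₅ , _) = inj₂ t≡c₅

      left : c (b + 1) ∈ L
      left with c (b + 1) ∈? L
      ... | yes c₁∈L = c₁∈L
      ... | no o1 = ⊥-elim (single-separator only-c₀ (isL _ _ o1 o3 (rim-distinct b 1 2 num≤ num≤)))
        where
        only-c₀ : ∀ {t} → t ∈ L → Separates t (c (b + 1)) (c (b + 3)) → t ≡ c (b + 0)
        only-c₀ t∈L sep with separator-position b 0 2 t∈L o1 o3 sep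
        ... | inj₁ (inj₁ t≡c₀ , _) = t≡c₀
        ... | inj₁ (inj₂ t≡c₂ , c₃≁t) = ⊥-elim (c₃≁t (subst (Adj _) (sym t≡c₂) (rim-adjacent′ b 2)))
        ... | inj₂ (inj₁ t≡c₂ , c₁≁t) = ⊥-elim (c₁≁t (subst (Adj _) (sym t≡c₂) (rim-adjacent b 1)))
        ... | inj₂ (inj₂ t≡c₄ , _) = ⊥-elim (o4 (∈-resp t≡c₄ t∈L))

      right : c (b + 6) ∈ L
      right with c (b + 6) ∈? L
      ... | yes c₆∈L = c₆∈L
      ... | no o6 = ⊥-elim (single-separator only-c₇ (isL _ _ o4 o6 (rim-distinct b 4 2 num≤ num≤)))
        where
        only-c₇ : ∀ {t} → t ∈ L → Separates t (c (b + 4)) (c (b + 6)) → t ≡ c (b + 7)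
        only-c₇ t∈L sep with separator-position b 3 5 t∈L o4 o6 sep
        ... | inj₁ (inj₁ t≡c₃ , _) = ⊥-elim (o3 (∈-resp t≡c₃ t∈L))
        ... | inj₁ (inj₂ t≡c₅ , c₆≁t) = ⊥-elim (c₆≁t (subst (Adj _) (sym t≡c₅) (rim-adjacent′ b 5)))
        ... | inj₂ (inj₁ t≡c₅ , c₄≁t) = ⊥-elim (c₄≁t (subst (Adj _) (sym t≡c₅) (rim-adjacent b 4)))
        ... | inj₂ (inj₂ t≡c₇ , _) = t≡c₇

    ∉-resp : ∀ {x y} → x ≡ y → x ∉ L → y ∉ L
    ∉-resp x≡y x∉L y∈L = x∉L (∈-resp (sym x≡y) y∈L)

    module Sufficiency (flanked : Flanked L) where

      flanked-at : ∀ b j → c (b + (j + 3)) ∉ L → c (b + (j + 4)) ∉ L →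
        c (b + (j + 1)) ∈ L × c (b + (j + 2)) ∈ L × c (b + (j + 5)) ∈ L × c (b + (j + 6)) ∈ L
      flanked-at b j o3 o4
        with flanked (b + j) (∉-resp (sym (c-reassoc b j 3)) o3) (∉-resp (sym (c-reassoc b j 4)) o4)
      ... | in₁ , in₂ , in₅ , in₆ = ∈-resp (c-reassoc b j 1) in₁ , ∈-resp (c-reassoc b j 2) in₂ ,
                                    ∈-resp (c-reassoc b j 5) in₅ , ∈-resp (c-reassoc b j 6) in₆

      -- Adjacent non-landmarks c_{b+4}, c_{b+5}: separated by the landmarks c_{b+3} and c_{b+6}.
      adjacent-pair : ∀ b → c (b + 4) ∉ L → c (b + 5) ∉ L → SeparatedBy 2 L (c (b + 4)) (c (b + 5))
      adjacent-pair b o4 o5 with flanked-at b 1 o4 o5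
      ... | _ , in₃ , in₆ , _ = two⇒separatedBy (two (rim-distinct b 3 3 num≤ num≤) in₃ in₆
        (near-far⇒separates (rim-adjacent′ b 3) (far-sym (rim-far b 3 2 num≤ num≤)))
        (far-near⇒separates (rim-far b 4 2 num≤ num≤) (rim-adjacent b 5)))

      -- Non-landmarks c_{b+4}, c_{b+6}: c_{b+3} and c_{b+7} are landmarks (else c_{b+6}, resp. c_{b+4},
      -- would be one) and separate them.
      two-apart-pair : ∀ b → c (b + 4) ∉ L → c (b + 6) ∉ L → SeparatedBy 2 L (c (b + 4)) (c (b + 6))
      two-apart-pair b o4 o6 = two⇒separatedBy (two (rim-distinct b 3 4 num≤ num≤) in₃ in₇
        (near-far⇒separates (rim-adjacent′ b 3) (far-sym (rim-far b 3 3 num≤ num≤)))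
        (far-near⇒separates (rim-far b 4 3 num≤ num≤) (rim-adjacent b 6)))
        where
        in₃ : c (b + 3) ∈ L
        in₃ with c (b + 3) ∈? L
        ... | yes in₃ = in₃
        ... | no o3 = ⊥-elim (o6 (proj₂ (proj₂ (proj₂ (flanked-at b 0 o3 o4)))))
        in₇ : c (b + 7) ∈ L
        in₇ with c (b + 7) ∈? L
        ... | yes in₇ = in₇
        ... | no o7 = ⊥-elim (o4 (proj₁ (flanked-at b 3 o6 o7)))

      -- The hub and a non-landmark c_{b+6}: each of the pairs {c_{b+3}, c_{b+4}}, {c_{b+8}, c_{b+9}}
      -- contains a landmark (else c_{b+6} would be one), adjacent to the hub and far from c_{b+6}.
      hub-pair : ∀ b → c (b + 6) ∉ L → SeparatedBy 2 L hub (c (b + 6))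
      hub-pair b o6 = one-from-each left-landmark right-landmark
        (near-far⇒separates (spoke₂ _) (far-sym (rim-far b 3 3 num≤ num≤)))
        (near-far⇒separates (spoke₂ _) (far-sym (rim-far b 4 2 num≤ num≤)))
        (near-far⇒separates (spoke₂ _) (rim-far b 6 2 num≤ num≤))
        (near-far⇒separates (spoke₂ _) (rim-far b 6 3 num≤ num≤))
        (rim-distinct b 3 5 num≤ num≤) (rim-distinct b 3 6 num≤ num≤)
        (rim-distinct b 4 4 num≤ num≤) (rim-distinct b 4 5 num≤ num≤)
        where
        left-landmark : c (b + 3) ∈ L ⊎ c (b + 4) ∈ L
        left-landmark with c (b + 3) ∈? L | c (b + 4) ∈? L
        ... | yes in₃ | _ = inj₁ in₃
        ... | no _ | yes in₄ = inj₂ in₄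
        ... | no o3 | no o4 = ⊥-elim (o6 (proj₂ (proj₂ (proj₂ (flanked-at b 0 o3 o4)))))
        right-landmark : c (b + 8) ∈ L ⊎ c (b + 9) ∈ L
        right-landmark with c (b + 8) ∈? L | c (b + 9) ∈? L
        ... | yes in₈ | _ = inj₁ in₈
        ... | no _ | yes in₉ = inj₂ in₉
        ... | no o8 | no o9 = ⊥-elim (o6 (proj₁ (flanked-at b 5 o8 o9)))

      -- Non-landmarks c_{b+4}, c_{b+7+e} at rim distance 3 + e ≤ m − 3: one landmark among the two
      -- rim neighbours of each, and each such neighbour is far from the other vertex.
      distant-pair : ∀ b e → e ≤ suc k → c (b + 4) ∉ L → c (b + (7 + e)) ∉ L →
        SeparatedBy 2 L (c (b + 4)) (c (b + (7 + e)))
      distant-pair b e e≤1+k o4 o7 = one-from-each near-u near-v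
        (near-far⇒separates (rim-adjacent′ b 3) (far-sym (rim-far b 3 (4 + e) num≤ (offset<m 5 num≤))))
        (near-far⇒separates (rim-adjacent b 4) (far-sym (rim-far b 5 (2 + e) num≤ (offset<m 3 num≤))))
        (far-near⇒separates (rim-far b 4 (2 + e) num≤ (offset<m 3 num≤)) (rim-adjacent′ b (6 + e)))
        (far-near⇒separates (rim-far b 4 (4 + e) num≤ (offset<m 5 num≤)) (rim-adjacent b (7 + e)))
        (rim-distinct b 3 (3 + e) num≤ (offset<m 3 num≤)) (rim-distinct b 3 (5 + e) num≤ (offset<m 5 num≤))
        (rim-distinct b 5 (1 + e) num≤ (offset<m 1 num≤)) (rim-distinct b 5 (3 + e) num≤ (offset<m 3 num≤))
        where
        offset<m : ∀ j → j ≤ 5 → j + e < m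
        offset<m j j≤5 = s≤s (+-mono-≤ j≤5 e≤1+k)
        near-u : c (b + 3) ∈ L ⊎ c (b + 5) ∈ L
        near-u with c (b + 3) ∈? L
        ... | yes in₃ = inj₁ in₃
        ... | no o3 = inj₂ (proj₁ (proj₂ (proj₂ (flanked-at b 0 o3 o4))))
        shifted : ∀ a → c ((b + e) + a) ≡ c (b + (a + e))
        shifted = c-shift b e
        near-v : c (b + (6 + e)) ∈ L ⊎ c (b + (8 + e)) ∈ L
        near-v with c (b + (6 + e)) ∈? L
        ... | yes in₆ = inj₁ in₆
        ... | no o6 = inj₂ (∈-resp (shifted 8) (proj₁ (proj₂ (proj₂
                (flanked-at (b + e) 3 (∉-resp (sym (shifted 6)) o6) (∉-resp (sym (shifted 7)) o7))))))

      -- Non-landmarks c_{b+4} and c_{b+4+d}, 0 < d < m, by the rim distance min(d, m − d).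
      rim-pair : ∀ b d → 0 < d → d < m → c (b + 4) ∉ L → c (b + (4 + d)) ∉ L →
        SeparatedBy 2 L (c (b + 4)) (c (b + (4 + d)))
      rim-pair b 1 _ _ = adjacent-pair b
      rim-pair b 2 _ _ = two-apart-pair b
      rim-pair b (suc (suc (suc e))) _ d<m o o′ with <-cmp e (2 + k)
      ... | tri< e<2+k _ _ = distant-pair b e (≤-pred e<2+k) o o′
      ... | tri≈ _ refl _ = subst₂ (SeparatedBy 2 L) to-u from-v
              (separatedBy-sym (two-apart-pair b′ (∉-resp (sym from-v) o′) (∉-resp (sym to-u) o)))
        where
        -- d = m − 2: seen from c_{b+4+d}, the vertex c_{b+4} is two steps ahead.
        b′ = b + (5 + k)
        from-v : c (b′ + 4) ≡ c (b + (9 + k))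
        from-v = c-shift b (5 + k) 4
        to-u : c (b′ + 6) ≡ c (b + 4)
        to-u = trans (c-shift b (5 + k) 6) (c-wrap b 4)
      ... | tri> _ _ 2+k<e with <-cmp e (3 + k)
      ...   | tri< e<3+k _ _ = ⊥-elim (<-irrefl refl (≤-trans 2+k<e (≤-pred e<3+k)))
      ...   | tri≈ _ refl _ = subst₂ (SeparatedBy 2 L) to-u from-v
              (separatedBy-sym (adjacent-pair b′ (∉-resp (sym from-v) o′) (∉-resp (sym to-u) o)))
        where
        -- d = m − 1: seen from c_{b+4+d}, the vertex c_{b+4} is the next one.
        b′ = b + (6 + k)
        from-v : c (b′ + 4) ≡ c (b + (10 + k))
        from-v = c-shift b (6 + k) 4
        to-u : c (b′ + 5) ≡ c (b + 4)
        to-u = trans (c-shift b (6 + k) 5) (c-wrap b 4)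
      ...   | tri> _ _ 3+k<e = ⊥-elim (<-irrefl refl (≤-trans (≤-pred (≤-pred (≤-pred d<m))) 3+k<e))

      -- Every pair of distinct non-landmarks, re-anchored so that a rim vertex sits at offset 4 or 6.
      every-pair-separated : IsNLLandmark 2 L
      every-pair-separated fzero fzero _ _ u≢v = ⊥-elim (u≢v refl)
      every-pair-separated fzero (fsuc q) _ o _ =
        subst (SeparatedBy 2 L hub) at-q (hub-pair b (∉-resp (sym at-q) o))
        where
        b = toℕ q + suc k
        at-q : c (b + 6) ≡ fsuc q
        at-q = anchor q 6 (suc k) refl
      every-pair-separated (fsuc p) fzero o o′ _ = separatedBy-sym (every-pair-separated fzero (fsuc p) o′ o (λ ()))
      every-pair-separated (fsuc p) (fsuc q) o o′ p≢q
        with index-difference (toℕ p) (toℕ q) (Fin.toℕ<n p) (Fin.toℕ<n q) (λ e → p≢q (cong fsuc (Fin.toℕ-injective e)))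
      ... | d , 0<d , d<m , p+d≈q =
        subst₂ (SeparatedBy 2 L) at-p at-q (rim-pair b d 0<d d<m (∉-resp (sym at-p) o) (∉-resp (sym at-q) o′))
        where
        b = toℕ p + (3 + k)
        at-p : c (b + 4) ≡ fsuc p
        at-p = anchor p 4 (3 + k) refl
        at-q : c (b + (4 + d)) ≡ fsuc q
        at-q = begin
          c (b + (4 + d))               ≡⟨ c-shift (toℕ p) (3 + k) (4 + d) ⟩
          c (toℕ p + ((4 + d) + (3 + k))) ≡⟨ cong c (regroup (toℕ p) d k) ⟩
          c ((toℕ p + d) + m)           ≡⟨ c-periodic (toℕ p + d) ⟩
          c (toℕ p + d)                 ≡⟨ ≈⇒c≡ p+d≈q ⟩
          c (toℕ q)                     ≡⟨ c-toℕ q ⟩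
          fsuc q                        ∎
          where
          open ≡-Reasoning
          regroup : ∀ i d k → i + ((4 + d) + (3 + k)) ≡ (i + d) + (7 + k)
          regroup = solve-∀

    flanked⇒landmark : Flanked L → IsNLLandmark 2 L
    flanked⇒landmark flanked = Sufficiency.every-pair-separated flanked

  -- The condition as stated in the theorem, with c_{i−2}, c_{i−1} written c_{i+(m−2)}, c_{i+(m−1)};
  -- it is the local condition anchored at b = i − 3.
  StatedCondition : Subset (suc m) → Set
  StatedCondition L = ∀ (i : ℕ) → cyc m i ∉ L → cyc m (i + 1) ∉ L →
    (cyc m (i + (m ∸ 2)) ∈ L × cyc m (i + (m ∸ 1)) ∈ L × cyc m (i + 2) ∈ L × cyc m (i + 3) ∈ L)

  module _ (L : Subset (suc m)) where

    stated⇒flanked : StatedCondition L → Flanked L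
    stated⇒flanked stated b o3 o4 with stated (b + 3) o3 (∉-resp L (sym (c-reassoc b 3 1)) o4)
    ... | in₁ , in₂ , in₅ , in₆ =
      ∈-resp L (trans (c-reassoc b 3 (5 + k)) (c-wrap b 1)) in₁ ,
      ∈-resp L (trans (c-reassoc b 3 (6 + k)) (c-wrap b 2)) in₂ ,
      ∈-resp L (c-reassoc b 3 2) in₅ , ∈-resp L (c-reassoc b 3 3) in₆

    flanked⇒stated : Flanked L → StatedCondition L
    flanked⇒stated flanked i o o′
      with flanked (i + (4 + k)) (∉-resp L (sym (trans (c-shift i (4 + k) 3) (c-periodic i))) o)
                                 (∉-resp L (sym (trans (c-shift i (4 + k) 4) (c-wrap i 1))) o′)
    ... | in₋₂ , in₋₁ , in₂ , in₃ =
      ∈-resp L (c-shift i (4 + k) 1) in₋₂ , ∈-resp L (c-shift i (4 + k) 2) in₋₁ ,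
      ∈-resp L (trans (c-shift i (4 + k) 5) (c-wrap i 2)) in₂ ,
      ∈-resp L (trans (c-shift i (4 + k) 6) (c-wrap i 3)) in₃

  module RimCount (h : Bool) (t : Subset m) where

    L : Subset (suc m)
    L = h ∷ t

    x : ℕ → ℕ
    x j = ind (lookup t (j mod m))

    rim-landmarks : ∣ t ∣ ≡ sumTo x m
    rim-landmarks = ∣∣-as-sum t x (λ i → cong (λ z → ind (lookup t z)) (Fin.suc-injective (c-toℕ i)))

    x-periodic : ∀ j → x (j + m) ≡ x j
    x-periodic j = cong (λ z → ind (lookup t z)) (Fin.suc-injective (c-periodic j))

    membership : ∀ j → (c j ∈ L × x j ≡ 1) ⊎ (c j ∉ L × x j ≡ 0)
    membership j with lookup t (j mod m) in lookup≡
    ... | true = inj₁ (there (lookup⇒[]= (j mod m) t lookup≡) , refl)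
    ... | false = inj₂ ((λ { (there j∈t) → true≢false (trans (sym ([]=⇒lookup j∈t)) lookup≡) }) , refl)
      where
      true≢false : ¬ true ≡ false
      true≢false ()

    both-in : ∀ a b → c a ∈ L → c b ∈ L → x a + x b ≡ 2
    both-in a b a∈L b∈L with membership a | membership b
    ... | inj₁ (_ , xa≡1) | inj₁ (_ , xb≡1) = cong₂ _+_ xa≡1 xb≡1
    ... | inj₂ (a∉L , _) | _ = ⊥-elim (a∉L a∈L)
    ... | _ | inj₂ (b∉L , _) = ⊥-elim (b∉L b∈L)

    pair : ∀ a b → (c a ∉ L × c b ∉ L × x a + x b ≡ 0) ⊎ 1 ≤ x a + x b
    pair a b with membership a | membership b
    ... | inj₂ (a∉L , xa≡0) | inj₂ (b∉L , xb≡0) = inj₁ (a∉L , b∉L , cong₂ _+_ xa≡0 xb≡0)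
    ... | inj₁ (_ , xa≡1) | _ = inj₂ (subst (λ z → 1 ≤ z + x b) (sym xa≡1) (s≤s z≤n))
    ... | _ | inj₁ (_ , xb≡1) = inj₂ (subst (λ z → 1 ≤ x a + z) (sym xb≡1) (m≤n+m 1 (x a)))

    window-count : ℕ → ℕ
    window-count w = (x (w + 3) + x (w + 4)) + (x (w + 5) + x (w + 6))

    -- Under the local condition each window holds two landmarks: a gap in the first pair forces
    -- the second pair into L, and a gap in the second pair forces the first pair into L.
    window : Flanked L → ∀ w → 2 ≤ window-count w
    window flanked w with pair (w + 3) (w + 4) | pair (w + 5) (w + 6)
    ... | inj₁ (o3 , o4 , first≡0) | _ with flanked w o3 o4
    ...   | _ , _ , in₅ , in₆ = subst (λ z → 2 ≤ z + (x (w + 5) + x (w + 6))) (sym first≡0)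
                                      (≤-reflexive (sym (both-in (w + 5) (w + 6) in₅ in₆)))
    window flanked w | inj₂ _ | inj₁ (o5 , o6 , second≡0)
      with flanked (w + 2) (∉-resp L (sym (c-reassoc w 2 3)) o5) (∉-resp L (sym (c-reassoc w 2 4)) o6)
    ...   | in₃ , in₄ , _ , _ = subst (λ z → 2 ≤ (x (w + 3) + x (w + 4)) + z) (sym second≡0)
            (≤-reflexive (sym (trans (+-identityʳ _)
              (both-in (w + 3) (w + 4) (∈-resp L (c-reassoc w 2 1) in₃) (∈-resp L (c-reassoc w 2 2) in₄)))))
    window flanked w | inj₂ 1≤first | inj₂ 1≤second = +-mono-≤ 1≤first 1≤second

    -- Each rim vertex lies in exactly four of the m windows.
    window-sum : sumTo window-count m ≡ (sumTo x m + sumTo x m) + (sumTo x m + sumTo x m)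
    window-sum = trans (sumTo-+ _ _ m) (cong₂ _+_ (pair-sum 3 4) (pair-sum 5 6))
      where
      pair-sum : ∀ a b → sumTo (λ w → x (w + a) + x (w + b)) m ≡ sumTo x m + sumTo x m
      pair-sum a b = trans (sumTo-+ (λ w → x (w + a)) (λ w → x (w + b)) m)
                           (cong₂ _+_ (sumTo-rotate m x x-periodic a) (sumTo-rotate m x x-periodic b))

  flanked-size : ∀ L → Flanked L → suc m / 2 ≤ ∣ L ∣
  flanked-size (h ∷ t) flanked = begin
    suc m / 2        ≤⟨ half-bound m s (begin
                          m * 2                   ≡⟨ sumTo-const 2 m ⟨
                          sumTo (λ _ → 2) m       ≤⟨ sumTo-mono m (window flanked) ⟩
                          sumTo window-count m    ≡⟨ window-sum ⟩
                          (s + s) + (s + s)       ∎) ⟩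
    s                ≡⟨ rim-landmarks ⟨
    ∣ t ∣            ≤⟨ m≤n+m ∣ t ∣ (ind h) ⟩
    ind h + ∣ t ∣    ≡⟨ ∣∷∣ h t ⟨
    ∣ h ∷ t ∣        ∎
    where
    open ≤-Reasoning
    open RimCount h t
    s = sumTo x m

  -- The alternating set c_0, c_2, c_4, … (hub excluded) has ⌈m/2⌉ elements and no gap at all.
  alternating-rim : Subset m
  alternating-rim = tabulate (λ i → alternating (toℕ i))

  alternating-set : Subset (suc m)
  alternating-set = outside ∷ alternating-rim

  alternating-set-size : ∣ alternating-set ∣ ≡ suc m / 2
  alternating-set-size =
    trans (∣∣-as-sum alternating-rim (λ j → ind (alternating j))
                     (λ i → cong ind (sym (lookup∘tabulate (λ i → alternating (toℕ i)) i))))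
          (alternating-sum m)

  alternating-member : ∀ j → alternating (j % m) ≡ true → c j ∈ alternating-set
  alternating-member j even = there (lookup⇒[]= (j mod m) alternating-rim
    (trans (lookup∘tabulate (λ i → alternating (toℕ i)) (j mod m)) (trans (cong alternating (toℕ-mod j)) even)))

  alternating-no-gap : ∀ j → c j ∈ alternating-set ⊎ c (suc j) ∈ alternating-set
  alternating-no-gap j with suc-mod j
  ... | inj₁ (next , _) with alternating-covers (j % m)
  ...   | inj₁ even = inj₁ (alternating-member j even)
  ...   | inj₂ odd = inj₂ (alternating-member (suc j) (trans (cong alternating next) odd))
  alternating-no-gap j | inj₂ (wraps , _) = inj₂ (alternating-member (suc j) (cong alternating wraps))

  alternating-set-flanked : Flanked alternating-set
  alternating-set-flanked b o3 o4 with alternating-no-gap (b + 3)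
  ... | inj₁ in₃ = ⊥-elim (o3 in₃)
  ... | inj₂ in₄ = ⊥-elim (o4 (∈-resp alternating-set (cong c (sym (+-suc b 3))) in₄))

  minimum : MdNL m 2 (suc m / 2)
  minimum = (alternating-set , flanked⇒landmark alternating-set alternating-set-flanked , alternating-set-size)
          , λ L isL → flanked-size L (landmark⇒flanked L isL)


mainTheorem11 : (m : ℕ) → .{{_ : NonZero m}} → 8 ≤ suc m →
    (∀ (L : Subset (suc m)) → hub ∉ L →
      (IsNLLandmark 2 L ⇔
        (∀ (i : ℕ) → cyc m i ∉ L → cyc m (i + 1) ∉ L →
          (cyc m (i + (m ∸ 2)) ∈ L × cyc m (i + (m ∸ 1)) ∈ L
            × cyc m (i + 2) ∈ L × cyc m (i + 3) ∈ L))))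
    × MdNL m 2 (suc m / 2)
mainTheorem11 (suc (suc (suc (suc (suc (suc (suc k))))))) _ = characterisation , minimum
  where
  open Landmarks k
  -- Both directions hold for every L.
  characterisation : ∀ L → hub ∉ L → IsNLLandmark 2 L ⇔ StatedCondition L
  characterisation L _ = mk⇔ (λ isL → flanked⇒stated L (landmark⇒flanked L isL))
                             (λ stated → flanked⇒landmark L (stated⇒flanked L stated))
mainTheorem11 (suc (suc (suc (suc (suc (suc zero)))))) (s≤s (s≤s (s≤s (s≤s (s≤s (s≤s (s≤s ())))))))
mainTheorem11 (suc (suc (suc (suc (suc zero))))) (s≤s (s≤s (s≤s (s≤s (s≤s (s≤s ()))))))
mainTheorem11 (suc (suc (suc (suc zero)))) (s≤s (s≤s (s≤s (s≤s (s≤s ())))))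
mainTheorem11 (suc (suc (suc zero))) (s≤s (s≤s (s≤s (s≤s ()))))
mainTheorem11 (suc (suc zero)) (s≤s (s≤s (s≤s ())))
mainTheorem11 (suc zero) (s≤s (s≤s ()))
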